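{- Let $\Sigma=\{0,1\}$, let $S=\{x\in\{0,1\}^{\omega^2} : \exists m\ \exists^\infty n\ x(m,n)=1\}$ (the set of $x$ having some column $m$ with infinitely many entries equal to $1$), and let $h:\Sigma^{\omega^2}\to((\Sigma\cup\{A\})\times(\Sigma\cup\{A\}))^\omega$ be the coding map described in the context. Then the set $\mathcal{S}=h(S)\cup\big(((\Sigma\cup\{A\})\times(\Sigma\cup\{A\}))^\omega - h(\Sigma^{\omega^2})\big)$ is a ${\bf \Sigma^0_3}$-complete subset of $((\Sigma\cup\{A\})\times(\Sigma\cup\{A\}))^\omega$.
   Context: $\Sigma^{\omega^2}$ is the set of families $x=(x(m,n))_{m\ge1,n\ge1}$ of letters of $\Sigma$; for fixed $m$, $x(m,1)x(m,2)\cdots$ is the $m$-th column of $x$. $A$ is a letter not in $\Sigma$. For $p\ge2$ let $B_p(x)=x(p,1)x(p-1,2)\cdots x(2,p-1)x(1,p)$ and $B'_p(x)=x(1,p)x(2,p-1)\cdots x(p-1,2)x(p,1)$. Define $\sigma_1=x(1,1)\,A\,B_2(x)\,A\,B_4(x)\,A\,B_6(x)\,A\cdots$ (blocks $B_p$ for even $p\ge2$, in increasing order, each followed by $A$) and $\sigma_2=A\,B'_3(x)\,A\,B'_5(x)\,A\,B'_7(x)\,A\cdots$ (blocks $B'_p$ for odd $p\ge3$, in increasing order, each followed by $A$). Then $h(x)$ is the $\omega$-word $(\sigma_1(1),\sigma_2(1))(\sigma_1(2),\sigma_2(2))\cdots$ over $(\Sigma\cup\{A\})\times(\Sigma\cup\{A\})$.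 $X^\omega$ carries the Cantor topology; the classes ${\bf \Sigma^0_n},{\bf \Pi^0_n}$ are the finite levels of the Borel hierarchy (open, closed, then alternately countable unions of ${\bf \Pi^0_n}$ sets and countable intersections of ${\bf \Sigma^0_n}$ sets). A set $F\subseteq X^\omega$ is ${\bf \Sigma^0_3}$-complete iff for every finite alphabet $Y$ and $E\subseteq Y^\omega$: $E\in{\bf \Sigma^0_3}$ iff $E=f^{ -1}(F)$ for some continuous $f:Y^\omega\to X^\omega$. -}

module Defs where

open import Level using (0ℓ; Lift)
open import Data.Bool using (Bool; true)
open import Data.Nat using (ℕ; zero; suc; _+_; _*_; _∸_; _≤_; _<_)
open import Data.Fin using (Fin)
open import Data.List using (List; []; _∷_; applyUpTo; map)
open import Data.List.NonEmpty using (List⁺; _∷_; _∷ʳ_)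
open import Data.Product using (Σ; ∃; _×_; _,_)
open import Data.Sum using (_⊎_)
open import Data.Empty using (⊥)
open import Relation.Nullary using (¬_)
open import Relation.Binary.PropositionalEquality using (_≡_)

Word : Set → Set
Word X = ℕ → X

PredW : Set → Set₁
PredW X = Word X → Set

Agree : {X : Set} → ℕ → Word X → Word X → Set
Agree n u v = ∀ i → i < n → u i ≡ v i

Open : {X : Set} → PredW X → Set
Open E = ∀ u → E u → ∃ λ n → ∀ v → Agree n u v → E v

∁ : {X : Set} → PredW X → PredW X
∁ E u = ¬ E u

-- Finite Borel levels.  Σ⁰ n E means E ∈ Σ^0_n (only n ≥ 1 is meaningful;
-- Σ⁰ 0 is empty):
--   Σ^0_1 = open sets,
--   Σ^0_{n+1} = countable unions of Π^0_n sets,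
--   Π^0_n = complements of Σ^0_n sets.
Σ⁰ : {X : Set} → ℕ → PredW X → Set₁
Π⁰ : {X : Set} → ℕ → PredW X → Set₁
Σ⁰ zero E = Lift _ ⊥
Σ⁰ (suc zero) E = Lift _ (Open E)
Σ⁰ (suc (suc n)) E =
  Σ (ℕ → PredW _) λ F → (∀ i → Π⁰ (suc n) (F i)) × (∀ u → (E u → ∃ λ i → F i u) × ((∃ λ i → F i u) → E u))
Π⁰ n E = Σ⁰ n (∁ E)

Continuous : {X Z : Set} → (Word X → Word Z) → Set
Continuous f = ∀ u k → ∃ λ n → ∀ v → Agree n u v → Agree k (f u) (f v)

-- F ⊆ X^ω is Σ^0_n-complete: for every finite alphabet Y (= Fin k) and every
-- E ⊆ Y^ω, E ∈ Σ^0_n iff E = f⁻¹(F) for some continuous f : Y^ω → X^ω.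
IsΣ⁰Complete : {X : Set} → ℕ → PredW X → Set₁
IsΣ⁰Complete {X} n F =
  ∀ (k : ℕ) (E : PredW (Fin k)) →
    (Σ⁰ n E → Σ (Word (Fin k) → Word X) λ f → Continuous f × (∀ u → (E u → F (f u)) × (F (f u) → E u)))
  × (Σ (Word (Fin k) → Word X) (λ f → Continuous f × (∀ u → (E u → F (f u)) × (F (f u) → E u))) → Σ⁰ n E)

data Letter : Set where
  b : Bool → Letter
  A : Letter

Pair : Set
Pair = Letter × Letter

-- Σ^{ω²}: x m n stands for x(m+1, n+1) of the paper (0-indexed)
Grid : Set
Grid = ℕ → ℕ → Bool

-- concatenation of an infinite sequence of nonempty finite words
-- go bs i r p : letter at position p of  r · bs(i+1) · bs(i+2) · …
go : {L : Set} → (ℕ → List⁺ L) → ℕ → List⁺ L → ℕ → L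
go bs i (a ∷ as) zero = a
go bs i (a ∷ []) (suc p) = go bs (suc i) (bs (suc i)) p
go bs i (a ∷ (c ∷ cs)) (suc p) = go bs i (c ∷ cs) p

concatω : {L : Set} → (ℕ → List⁺ L) → Word L
concatω bs = go bs 0 (bs 0)

-- B_p(x) = x(p,1) x(p-1,2) ⋯ x(1,p)
B : Grid → ℕ → List Letter
B x p = applyUpTo (λ i → b (x (p ∸ 1 ∸ i) i)) p

-- B'_p(x) = x(1,p) x(2,p-1) ⋯ x(p,1)
B' : Grid → ℕ → List Letter
B' x p = applyUpTo (λ i → b (x i (p ∸ 1 ∸ i))) p

-- σ₁ = x(1,1) A B_2 A B_4 A B_6 A ⋯   (blocks: "x(1,1) A", "B_{2j} A")
blocks₁ : Grid → ℕ → List⁺ Letter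
blocks₁ x zero = b (x 0 0) ∷ (A ∷ [])
blocks₁ x (suc j) = B x (2 * suc j) ∷ʳ A

-- σ₂ = A B'_3 A B'_5 A B'_7 ⋯   (blocks: "A B'_{2j+3}")
blocks₂ : Grid → ℕ → List⁺ Letter
blocks₂ x j = A ∷ B' x (2 * j + 3)

σ₁ : Grid → Word Letter
σ₁ x = concatω (blocks₁ x)

σ₂ : Grid → Word Letter
σ₂ x = concatω (blocks₂ x)

h : Grid → Word Pair
h x n = (σ₁ x n , σ₂ x n)

S : Grid → Set
S x = ∃ λ m → ∀ N → ∃ λ n → N ≤ n × x m n ≡ true

-- y ∈ h(S) ∪ (Pair^ω − h(Σ^{ω²}))   (images taken up to pointwise equality)
𝒮 : PredW Pair
𝒮 y = (∃ λ x → S x × (∀ i → h x i ≡ y i)) ⊎ ¬ (∃ λ x → ∀ i → h x i ≡ y i)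

module Submission where

-- The bit x(m,n) is stored at one fixed position of h x, so h has a
-- continuous left inverse `decode`.  Hence y lies in the image of h iff
-- h (decode y) = y, a closed condition, and then y ∈ h(S) iff some column of
-- decode y has infinitely many 1s, a Π⁰₂ condition for each column.  So 𝒮 is the
-- union of the open set ∁ Image and countably many Π⁰₂ sets, i.e. Σ⁰₃; since
-- Σ⁰ n is closed under continuous preimages, every E = f⁻¹(𝒮) is Σ⁰₃ too.
--
-- A Π⁰₂ set P = ⋂ⱼ ∁ Gⱼ (Gⱼ closed) reduces causally to "infinitely many
-- 1s": a signal fires at n when the cylinder of length n avoids G₀ … G_c, c the
-- number of earlier firings.  For E = ⋃ᵢ Pᵢ put the signal of Pᵢ in column i of a
-- grid g u; then u ∈ E iff g u ∈ S iff h (g u) ∈ 𝒮, as h is injective.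

open import Level using (0ℓ; lift; lower)
open import Axiom.ExcludedMiddle using (ExcludedMiddle)
open import Axiom.DoubleNegationElimination using (em⇒dne)
open import Defs

open import Data.Bool using (Bool; true; false; if_then_else_)
open import Data.Bool.Properties using (¬-not)
open import Data.Nat using (ℕ; zero; suc; _+_; _*_; _∸_; _≤_; _<_; z≤n; s≤s)
open import Data.Nat.Properties
open import Data.Nat.Tactic.RingSolver using (solve-∀)
open import Data.List as List using (List; []; _∷_; applyUpTo; _++_)
open import Data.List.Properties using (length-++; length-applyUpTo; ++-identityʳ)
open import Data.List.NonEmpty as List⁺ using (List⁺; _∷_; _∷ʳ_)
open import Data.Product using (Σ; ∃; _×_; _,_; proj₁; proj₂)
open import Data.Sum using (_⊎_; inj₁; inj₂)
open import Data.Empty using (⊥-elim)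
open import Function.Bundles using (_⇔_; mk⇔; Equivalence)
open import Function.Properties.Equivalence using () renaming (sym to ⇔-sym; trans to ⇔-trans)
open import Function.Related.TypeIsomorphisms using (¬-cong-⇔)
open import Relation.Nullary using (¬_; Dec; yes; no; does)
open import Relation.Nullary.Decidable using (dec-true; does-⇔)
open import Relation.Binary.PropositionalEquality

open Equivalence using (to; from)

-- The Cantor topology

Agree-weaken : ∀ {X : Set} {m n} {u v : Word X} → m ≤ n → Agree n u v → Agree m u v
Agree-weaken m≤n a i i<m = a i (<-≤-trans i<m m≤n)

Agree-trans : ∀ {X : Set} {n} {u v w : Word X} → Agree n u v → Agree n v w → Agree n u w
Agree-trans a a' i i<n = trans (a i i<n) (a' i i<n)

Agree-sym : ∀ {X : Set} {n} {u v : Word X} → Agree n u v → Agree n v u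
Agree-sym a i i<n = sym (a i i<n)

common-threshold : (Q : ℕ → ℕ → Set) → (∀ j {a c} → a ≤ c → Q j a → Q j c) →
                   ∀ K → (∀ j → j < K → ∃ (Q j)) → ∃ λ N → ∀ j → j < K → Q j N
common-threshold Q mono zero _ = 0 , λ _ ()
common-threshold Q mono (suc K) each
  with common-threshold Q mono K (λ j j<K → each j (m<n⇒m<1+n j<K)) | each K (n<1+n K)
... | N₁ , below | N₂ , atK = N₁ + N₂ , λ j j<1+K → split j (m≤n⇒m<n∨m≡n (≤-pred j<1+K))
  where
    split : ∀ j → j < K ⊎ j ≡ K → Q j (N₁ + N₂)
    split j (inj₁ j<K) = mono j (m≤m+n N₁ N₂) (below j j<K)
    split j (inj₂ refl) = mono j (m≤n+m N₂ N₁) atK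

Σ⁰-preimage : ∀ {X Z : Set} n {E : PredW Z} (f : Word X → Word Z) → Continuous f →
              Σ⁰ n E → Σ⁰ n (λ u → E (f u))
Σ⁰-preimage zero f _ (lift ())
Σ⁰-preimage (suc zero) f f-cont (lift E-open) = lift λ u Efu →
  let k , ball = E-open (f u) Efu ; n , mod = f-cont u k in n , λ v a → ball (f v) (mod v a)
Σ⁰-preimage (suc (suc n)) f f-cont (F , F-Π , E⇔⋃F) =
  (λ i u → F i (f u)) , (λ i → Σ⁰-preimage (suc n) f f-cont (F-Π i)) , (λ u → E⇔⋃F (f u))

Σ⁰-resp : ∀ {X : Set} n {E E' : PredW X} → (∀ u → E u ⇔ E' u) → Σ⁰ n E → Σ⁰ n E'
Σ⁰-resp zero _ (lift ())
Σ⁰-resp (suc zero) E⇔E' (lift E-open) = lift λ u E'u →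
  let k , ball = E-open u (from (E⇔E' u) E'u) in k , λ v a → to (E⇔E' v) (ball v a)
Σ⁰-resp (suc (suc n)) E⇔E' (F , F-Π , E⇔⋃F) = F , F-Π , λ u →
  (λ E'u → proj₁ (E⇔⋃F u) (from (E⇔E' u) E'u)) , (λ w → to (E⇔E' u) (proj₂ (E⇔⋃F u) w))

id-continuous : ∀ {X : Set} → Continuous {X} (λ u → u)
id-continuous u k = k , λ _ a → a

module Classical (em : ExcludedMiddle 0ℓ) where

  dne : {P : Set} → ¬ ¬ P → P
  dne = em⇒dne em

  ¬∀¬⇒∃ : {X : Set} {P : X → Set} → ¬ (∀ x → ¬ P x) → ∃ P
  ¬∀¬⇒∃ none = dne λ ¬∃ → none (λ x p → ¬∃ (x , p))

  ¬∀⇒∃¬ : {X : Set} {P : X → Set} → ¬ (∀ x → P x) → ∃ λ x → ¬ P x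
  ¬∀⇒∃¬ ¬all = ¬∀¬⇒∃ λ none → ¬all (λ x → dne (none x))

  equaliser-closed : ∀ {Z W : Set} (φ ψ : Word Z → Word W) → Continuous φ → Continuous ψ →
                     Open (∁ λ y → ∀ i → φ y i ≡ ψ y i)
  equaliser-closed φ ψ φ-cont ψ-cont y differ =
    let i , φ≢ψ = ¬∀⇒∃¬ differ
        n₁ , φ-mod = φ-cont y (suc i)
        n₂ , ψ-mod = ψ-cont y (suc i)
    in n₁ + n₂ , λ v a equal →
         φ≢ψ (trans (φ-mod v (Agree-weaken (m≤m+n n₁ n₂) a) i (n<1+n i))
               (trans (equal i) (sym (ψ-mod v (Agree-weaken (m≤n+m n₂ n₁) a) i (n<1+n i)))))

  -- An open set is Π⁰₂: its complement is the (constant) union of a closed set.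
  open⇒Π⁰₂ : ∀ {X : Set} {P : PredW X} → Open P → Π⁰ 2 P
  open⇒Π⁰₂ {P = P} P-open = (λ _ → ∁ P) , (λ _ → lift ∁∁P-open) , λ u → (λ ¬Pu → 0 , ¬Pu) , proj₂
    where
      ∁∁P-open : Open (∁ (∁ P))
      ∁∁P-open u ¬¬Pu = let n , ball = P-open u (dne ¬¬Pu) in n , λ v a ¬Pv → ¬Pv (ball v a)

InfinitelyOften : Word Bool → Set
InfinitelyOften α = ∀ N → ∃ λ n → N ≤ n × α n ≡ true

InfinitelyOften-resp : ∀ {α β} → (∀ n → α n ≡ β n) → InfinitelyOften α → InfinitelyOften β
InfinitelyOften-resp α≗β io N = let n , N≤n , fire = io N in n , N≤n , trans (sym (α≗β n)) fire

LocallyDetermined : {Z : Set} → (Word Z → Word Bool) → Set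
LocallyDetermined β = ∀ y n → ∃ λ N → ∀ v → Agree N y v → β y n ≡ β v n

module _ (em : ExcludedMiddle 0ℓ) where
  open Classical em

  -- "Infinitely many 1s" pulled back along a locally determined map is Π⁰₂:
  -- its complement is the union over N of the closed sets "no 1 after N".
  InfinitelyOften-Π⁰₂ : ∀ {Z : Set} (β : Word Z → Word Bool) → LocallyDetermined β →
                        Π⁰ 2 (λ y → InfinitelyOften (β y))
  InfinitelyOften-Π⁰₂ {Z} β β-local =
    Quiet , (λ N → lift (quiet-closed N)) , λ y → eventually-quiet y , not-infinitely y
    where
      Quiet : ℕ → PredW Z
      Quiet N y = ∀ n → ¬ (N ≤ n × β y n ≡ true)

      quiet-closed : ∀ N → Open (∁ (Quiet N))
      quiet-closed N y loud =
        let n , N≤n , fire = ¬∀¬⇒∃ loud ; K , mod = β-local y n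
        in K , λ v a quiet → quiet n (N≤n , trans (sym (mod v a)) fire)

      eventually-quiet : ∀ y → ¬ InfinitelyOften (β y) → ∃ λ N → Quiet N y
      eventually-quiet y ¬io = let N , silent = ¬∀⇒∃¬ ¬io in N , λ n w → silent (n , w)

      not-infinitely : ∀ y → (∃ λ N → Quiet N y) → ¬ InfinitelyOften (β y)
      not-infinitely y (N , quiet) io = let n , N≤n , fire = io N in quiet n (N≤n , fire)

-- Infinite concatenation of nonempty blocks

-- blockStart ℓ j = ℓ 0 + … + ℓ (j - 1), the position of block j when block i has length ℓ i.
blockStart : (ℕ → ℕ) → ℕ → ℕ
blockStart ℓ zero = 0
blockStart ℓ (suc j) = blockStart ℓ j + ℓ j

module _ {L : Set} (bs : ℕ → List⁺ L) where

  go-skip : ∀ i a as q → go bs i (a ∷ as) (List⁺.length (a ∷ as) + q) ≡ go bs (suc i) (bs (suc i)) q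
  go-skip i a [] q = refl
  go-skip i a (c ∷ cs) q = go-skip i c cs q

  concatω-block : (ℓ : ℕ → ℕ) → (∀ j → List⁺.length (bs j) ≡ ℓ j) →
                  ∀ j q → concatω bs (blockStart ℓ j + q) ≡ go bs j (bs j) q
  concatω-block ℓ len zero q = refl
  concatω-block ℓ len (suc j) q = begin
    concatω bs (blockStart ℓ j + ℓ j + q)                   ≡⟨ cong (concatω bs) (+-assoc (blockStart ℓ j) (ℓ j) q) ⟩
    concatω bs (blockStart ℓ j + (ℓ j + q))                 ≡⟨ concatω-block ℓ len j (ℓ j + q) ⟩
    go bs j (bs j) (ℓ j + q)                                ≡⟨ cong (λ l → go bs j (bs j) (l + q)) (sym (len j)) ⟩
    go bs j (bs j) (List⁺.length (bs j) + q)                ≡⟨ go-skip j (List⁺.head (bs j)) (List⁺.tail (bs j)) q ⟩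
    go bs (suc j) (bs (suc j)) q                            ∎
    where open ≡-Reasoning

  go-applyUpTo : ∀ i a (f : ℕ → L) p zs m → m < p → go bs i (a ∷ (applyUpTo f p ++ zs)) (suc m) ≡ f m
  go-applyUpTo i a f (suc p) zs zero _ = refl
  go-applyUpTo i a f (suc p) zs (suc m) (s≤s m<p) = go-applyUpTo i (f 0) (λ t → f (suc t)) p zs m m<p

  go-cons-applyUpTo : ∀ i a (f : ℕ → L) p m → m < p → go bs i (a ∷ applyUpTo f p) (suc m) ≡ f m
  go-cons-applyUpTo i a f p m m<p =
    trans (cong (λ l → go bs i (a ∷ l) (suc m)) (sym (++-identityʳ (applyUpTo f p))))
          (go-applyUpTo i a f p [] m m<p)

  go-snoc-applyUpTo : ∀ i (f : ℕ → L) p a m → m < p → go bs i (applyUpTo f p ∷ʳ a) m ≡ f m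
  go-snoc-applyUpTo i f (suc p) a zero _ = refl
  go-snoc-applyUpTo i f (suc p) a (suc m) (s≤s m<p) = go-applyUpTo i (f 0) (λ t → f (suc t)) p (a ∷ []) m m<p

  module _ (bs' : ℕ → List⁺ L) where

    go-local : ∀ {B} i r p → i + p ≤ B → (∀ j → j ≤ B → bs j ≡ bs' j) → go bs i r p ≡ go bs' i r p
    go-local i (a ∷ as) zero _ _ = refl
    go-local {B} i (a ∷ []) (suc p) i+1+p≤B same =
      trans (cong (λ r → go bs (suc i) r p) (same (suc i) (≤-trans (s≤s (m≤m+n i p)) 1+i+p≤B)))
            (go-local (suc i) (bs' (suc i)) p 1+i+p≤B same)
      where
        1+i+p≤B : suc i + p ≤ B
        1+i+p≤B = subst (_≤ B) (+-suc i p) i+1+p≤B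
    go-local {B} i (a ∷ c ∷ cs) (suc p) i+1+p≤B same =
      go-local {B} i (c ∷ cs) p (≤-trans (+-monoʳ-≤ i (n≤1+n p)) i+1+p≤B) same

    concatω-local : ∀ p → (∀ j → j ≤ p → bs j ≡ bs' j) → concatω bs p ≡ concatω bs' p
    concatω-local p same = trans (cong (λ r → go bs 0 r p) (same 0 z≤n)) (go-local 0 (bs' 0) p ≤-refl same)

-- Continuity of the coding map h

SquareAgree : ℕ → Grid → Grid → Set
SquareAgree K x x' = ∀ m n → m < K → n < K → x m n ≡ x' m n

applyUpTo-cong : ∀ {L : Set} (f g : ℕ → L) p → (∀ i → i < p → f i ≡ g i) → applyUpTo f p ≡ applyUpTo g p
applyUpTo-cong f g zero _ = refl
applyUpTo-cong f g (suc p) f≗g =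
  cong₂ _∷_ (f≗g 0 (s≤s z≤n)) (applyUpTo-cong (λ t → f (suc t)) (λ t → g (suc t)) p (λ i i<p → f≗g (suc i) (s≤s i<p)))

antidiagonal-bound : ∀ {p K i} → i < p → p ≤ K → p ∸ 1 ∸ i < K
antidiagonal-bound {suc p} {K} {i} _ p≤K = <-≤-trans (s≤s (m∸n≤m p i)) p≤K

B-local : ∀ {K x x'} p → SquareAgree K x x' → p ≤ K → B x p ≡ B x' p
B-local p same p≤K = applyUpTo-cong _ _ p λ i i<p →
  cong b (same _ _ (antidiagonal-bound i<p p≤K) (<-≤-trans i<p p≤K))

B'-local : ∀ {K x x'} p → SquareAgree K x x' → p ≤ K → B' x p ≡ B' x' p
B'-local p same p≤K = applyUpTo-cong _ _ p λ i i<p →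
  cong b (same _ _ (<-≤-trans i<p p≤K) (antidiagonal-bound i<p p≤K))

-- Block j of σ₁ and block j of σ₂ only involve entries on antidiagonals of length ≤ 2j + 3.
blocks₁-local : ∀ {K x x'} j → SquareAgree K x x' → 2 * j + 3 ≤ K → blocks₁ x j ≡ blocks₁ x' j
blocks₁-local zero same 3≤K = cong (λ t → b t ∷ A ∷ []) (same 0 0 0<K 0<K)
  where
    0<K = ≤-trans (s≤s z≤n) 3≤K
blocks₁-local (suc j) same 2j+5≤K =
  cong (_∷ʳ A) (B-local (2 * suc j) same (≤-trans (m≤m+n (2 * suc j) 3) 2j+5≤K))

blocks₂-local : ∀ {K x x'} j → SquareAgree K x x' → 2 * j + 3 ≤ K → blocks₂ x j ≡ blocks₂ x' j
blocks₂-local j same 2j+3≤K = cong (A ∷_) (B'-local (2 * j + 3) same 2j+3≤K)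

h-square : ∀ k {x x'} → SquareAgree (2 * k + 3) x x' → Agree k (h x) (h x')
h-square k {x} {x'} same i i<k =
  cong₂ _,_ (concatω-local (blocks₁ x) (blocks₁ x') i λ j j≤i → blocks₁-local j same (bound j≤i))
            (concatω-local (blocks₂ x) (blocks₂ x') i λ j j≤i → blocks₂-local j same (bound j≤i))
  where
    bound : ∀ {j} → j ≤ i → 2 * j + 3 ≤ 2 * k + 3
    bound j≤i = +-monoˡ-≤ 3 (*-monoʳ-≤ 2 (≤-trans j≤i (<⇒≤ i<k)))

h-cong : ∀ {x x'} → (∀ m n → x m n ≡ x' m n) → ∀ i → h x i ≡ h x' i
h-cong same i = h-square (suc i) (λ m n _ _ → same m n) i (n<1+n i)

GridContinuous : {Z : Set} → (Word Z → Grid) → Set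
GridContinuous D = ∀ y K → ∃ λ N → ∀ v → Agree N y v → SquareAgree K (D y) (D v)

h∘-continuous : ∀ {Z : Set} (D : Word Z → Grid) → GridContinuous D → Continuous (λ y → h (D y))
h∘-continuous D D-cont y k = let N , mod = D-cont y (2 * k + 3) in N , λ v a → h-square k (mod v a)

entrywise⇒GridContinuous : ∀ {Z : Set} (D : Word Z → Grid) →
  (∀ y m n → ∃ λ N → ∀ v → Agree N y v → D y m n ≡ D v m n) → GridContinuous D
entrywise⇒GridContinuous {Z} D D-local y K =
  let N , square = common-threshold Row Row-mono K λ m _ →
                     common-threshold (Entry m) (Entry-mono m) K λ n _ → D-local y m n
  in N , λ v a m n m<K n<K → square m m<K n n<K v a
  where
    Entry : ℕ → ℕ → ℕ → Set
    Entry m n N = ∀ v → Agree N y v → D y m n ≡ D v m n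
    Entry-mono : ∀ m n {a c} → a ≤ c → Entry m n a → Entry m n c
    Entry-mono m n a≤c entry v a = entry v (Agree-weaken a≤c a)
    Row : ℕ → ℕ → Set
    Row m N = ∀ n → n < K → Entry m n N
    Row-mono : ∀ m {a c} → a ≤ c → Row m a → Row m c
    Row-mono m a≤c row n n<K = Entry-mono m n a≤c (row n n<K)

-- Decoding h

-- View of a number as j + j or 1 + j + j, selecting the track of an antidiagonal.
data Parity : ℕ → Set where
  even : ∀ j → Parity (j + j)
  odd  : ∀ j → Parity (suc (j + j))

parity : ∀ d → Parity d
parity zero = even 0
parity (suc d) with parity d
... | even j = odd j
... | odd j = subst Parity (cong suc (+-suc j j)) (even (suc j))

len₁ : ℕ → ℕ
len₁ zero = 2
len₁ (suc j) = suc (2 * suc j)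

len₂ : ℕ → ℕ
len₂ j = suc (2 * j + 3)

length-snoc : ∀ {L : Set} (xs : List L) a → List⁺.length (xs ∷ʳ a) ≡ suc (List.length xs)
length-snoc [] a = refl
length-snoc (x ∷ xs) a = cong suc (trans (length-++ xs) (+-comm (List.length xs) 1))

length-blocks₁ : ∀ x j → List⁺.length (blocks₁ x j) ≡ len₁ j
length-blocks₁ x zero = refl
length-blocks₁ x (suc j) =
  trans (length-snoc (B x (2 * suc j)) A) (cong suc (length-applyUpTo (λ i → b (x (2 * suc j ∸ 1 ∸ i) i)) (2 * suc j)))

length-blocks₂ : ∀ x j → List⁺.length (blocks₂ x j) ≡ len₂ j
length-blocks₂ x j = cong suc (length-applyUpTo (λ i → b (x i (2 * j + 3 ∸ 1 ∸ i))) (2 * j + 3))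

-- A location in a word of pairs: a track (proj₁ for σ₁, proj₂ for σ₂) and a position.
Location : Set
Location = (Pair → Letter) × ℕ

-- The bit written in a letter (A carries no bit).
toBool : Letter → Bool
toBool (b t) = t
toBool A = false

read : Location → Word Pair → Bool
read (track , pos) y = toBool (track (y pos))

-- Where h x stores x m n, according to d = m + n: d = 0 is the first letter of σ₁,
-- d = 2j + 1 is entry n of block j + 1 of σ₁ (that is B_{2j+2}), and d = 2j + 2 is
-- entry m of B'_{2j+3}, which follows the leading A of block j of σ₂.
locate : ∀ {d} → Parity d → ℕ → ℕ → Location
locate (even zero) m n = proj₁ , 0
locate (even (suc j)) m n = proj₂ , blockStart len₂ j + suc m
locate (odd j) m n = proj₁ , blockStart len₁ (suc j) + n

location : ℕ → ℕ → Location
location m n = locate (parity (m + n)) m n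

decode : Word Pair → Grid
decode y m n = read (location m n) y

decode-local : ∀ {y v} m n → Agree (suc (proj₂ (location m n))) y v → decode y m n ≡ decode v m n
decode-local m n a = cong (λ p → toBool (proj₁ (location m n) p)) (a _ (n<1+n _))

decode-continuous : GridContinuous decode
decode-continuous = entrywise⇒GridContinuous decode λ y m n → suc (proj₂ (location m n)) , λ v → decode-local m n

antidiagonal-col : ∀ {p m n} → p ≡ suc (m + n) → n < p × p ∸ 1 ∸ n ≡ m
antidiagonal-col {m = m} {n} refl = s≤s (m≤n+m n m) , m+n∸n≡m m n

antidiagonal-row : ∀ {p m n} → p ≡ suc (m + n) → m < p × p ∸ 1 ∸ m ≡ n
antidiagonal-row {m = m} {n} refl = s≤s (m≤m+n m n) , m+n∸m≡n m n

two-suc : ∀ j → 2 * suc j ≡ suc (suc (j + j))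
two-suc = solve-∀

two-plus-three : ∀ j → 2 * j + 3 ≡ suc (suc j + suc j)
two-plus-three = solve-∀

decode-locate : ∀ x m n {d} (π : Parity d) → d ≡ m + n → read (locate π m n) (h x) ≡ x m n
decode-locate x zero zero (even zero) _ = refl
decode-locate x zero (suc n) (even zero) ()
decode-locate x (suc m) n (even zero) ()
decode-locate x m n (even (suc j)) e = begin
  toBool (σ₂ x (blockStart len₂ j + suc m))
    ≡⟨ cong toBool (concatω-block (blocks₂ x) len₂ (length-blocks₂ x) j (suc m)) ⟩
  toBool (go (blocks₂ x) j (blocks₂ x j) (suc m))
    ≡⟨ cong toBool (go-cons-applyUpTo (blocks₂ x) j A (λ i → b (x i (2 * j + 3 ∸ 1 ∸ i))) (2 * j + 3) m (proj₁ entry)) ⟩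
  x m (2 * j + 3 ∸ 1 ∸ m)
    ≡⟨ cong (x m) (proj₂ entry) ⟩
  x m n ∎
  where
    open ≡-Reasoning
    entry = antidiagonal-row (trans (two-plus-three j) (cong suc e))
decode-locate x m n (odd j) e = begin
  toBool (σ₁ x (blockStart len₁ (suc j) + n))
    ≡⟨ cong toBool (concatω-block (blocks₁ x) len₁ (length-blocks₁ x) (suc j) n) ⟩
  toBool (go (blocks₁ x) (suc j) (blocks₁ x (suc j)) n)
    ≡⟨ cong toBool (go-snoc-applyUpTo (blocks₁ x) (suc j) (λ i → b (x (2 * suc j ∸ 1 ∸ i) i)) (2 * suc j) A n (proj₁ entry)) ⟩
  x (2 * suc j ∸ 1 ∸ n) n
    ≡⟨ cong (λ r → x r n) (proj₂ entry) ⟩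
  x m n ∎
  where
    open ≡-Reasoning
    entry = antidiagonal-col (trans (two-suc j) (cong suc e))

decode-h : ∀ x m n → decode (h x) m n ≡ x m n
decode-h x m n = decode-locate x m n (parity (m + n)) refl

decode-image : ∀ {x y} → (∀ i → h x i ≡ y i) → ∀ m n → decode y m n ≡ x m n
decode-image {x} hx≗y m n = trans (sym (decode-local m n (λ i _ → hx≗y i))) (decode-h x m n)

-- 𝒮 is Σ⁰₃

Image : PredW Pair
Image y = ∃ λ x → ∀ i → h x i ≡ y i

Image⇔fixed : ∀ y → Image y ⇔ (∀ i → h (decode y) i ≡ y i)
Image⇔fixed y = mk⇔ (λ (x , hx≗y) i → trans (h-cong (decode-image hx≗y) i) (hx≗y i))
                    (λ fixed → decode y , fixed)

𝒮-on-codes : ∀ x → 𝒮 (h x) ⇔ S x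
𝒮-on-codes x = mk⇔ in-S (λ Sx → inj₁ (x , Sx , λ _ → refl))
  where
    in-S : 𝒮 (h x) → S x
    in-S (inj₁ (x' , (m , io) , hx'≗hx)) =
      m , InfinitelyOften-resp (λ n → trans (sym (decode-image hx'≗hx m n)) (decode-h x m n)) io
    in-S (inj₂ not-code) = ⊥-elim (not-code (x , λ _ → refl))

Piece : ℕ → PredW Pair
Piece zero = ∁ Image
Piece (suc m) y = InfinitelyOften (decode y m)

module _ (em : ExcludedMiddle 0ℓ) where
  open Classical em

  -- The image of h is closed: it is the equaliser of y ↦ h (decode y) and the identity.
  Image-closed : Open (∁ Image)
  Image-closed = lower (Σ⁰-resp 1 (λ y → ¬-cong-⇔ (⇔-sym (Image⇔fixed y)))
    (lift (equaliser-closed (λ y → h (decode y)) (λ y → y) (h∘-continuous decode decode-continuous) id-continuous)))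

  𝒮⇔Pieces : ∀ y → 𝒮 y ⇔ (∃ λ i → Piece i y)
  𝒮⇔Pieces y = mk⇔ to-piece from-piece
    where
      to-piece : 𝒮 y → ∃ λ i → Piece i y
      to-piece (inj₁ (x , (m , io) , hx≗y)) = suc m , InfinitelyOften-resp (λ n → sym (decode-image hx≗y m n)) io
      to-piece (inj₂ not-code) = zero , not-code

      from-piece : (∃ λ i → Piece i y) → 𝒮 y
      from-piece (zero , not-code) = inj₂ not-code
      from-piece (suc m , io) with em {Image y}
      ... | yes (x , hx≗y) = inj₁ (x , (m , InfinitelyOften-resp (decode-image hx≗y m) io) , hx≗y)
      ... | no not-code = inj₂ not-code

  -- The pieces are Π⁰₂: the non-codes form an open set, and each bit of decode y m
  -- reads one letter of y.
  Piece-Π⁰₂ : ∀ i → Π⁰ 2 (Piece i)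
  Piece-Π⁰₂ zero = open⇒Π⁰₂ Image-closed
  Piece-Π⁰₂ (suc m) = InfinitelyOften-Π⁰₂ em (λ y → decode y m)
    (λ y n → suc (proj₂ (location m n)) , λ v → decode-local m n)

  𝒮-Σ⁰₃ : Σ⁰ 3 𝒮
  𝒮-Σ⁰₃ = Piece , Piece-Π⁰₂ , λ y → to (𝒮⇔Pieces y) , from (𝒮⇔Pieces y)

-- Π⁰₂ sets reduce to "infinitely many 1s"

does-true : ∀ {P : Set} (d : Dec P) → does d ≡ true → P
does-true (yes p) _ = p
does-true (no _) ()

-- For closed sets G j, a causal signal on u fires infinitely often iff u avoids all G j.
module Signal (em : ExcludedMiddle 0ℓ) {X : Set} (G : ℕ → PredW X) (G-closed : ∀ j → Open (∁ (G j))) where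
  open Classical em

  Avoids : ℕ → Word X → ℕ → Set
  Avoids j u n = ∀ v → Agree n u v → ¬ G j v

  Avoids-mono : ∀ {j u a c} → a ≤ c → Avoids j u a → Avoids j u c
  Avoids-mono a≤c avoids v a = avoids v (Agree-weaken a≤c a)

  mutual
    count : Word X → ℕ → ℕ
    count u zero = 0
    count u (suc n) = if signal u n then suc (count u n) else count u n

    Ready : Word X → ℕ → Set
    Ready u n = ∀ j → j ≤ count u n → Avoids j u n

    signal : Word X → ℕ → Bool
    signal u n = does (em {Ready u n})

  Ready-transfer : ∀ {u v} n → Agree n u v → count u n ≡ count v n → Ready u n → Ready v n
  Ready-transfer n a same-count ready j j≤c w avw =
    ready j (subst (j ≤_) (sym same-count) j≤c) w (Agree-trans a avw)

  mutual
    count-causal : ∀ {u v} n → Agree n u v → count u n ≡ count v n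
    count-causal zero _ = refl
    count-causal (suc n) a =
      cong₂ (λ s c → if s then suc c else c) (signal-causal n a′) (count-causal n a′)
      where
        a′ = Agree-weaken (n≤1+n n) a

    signal-causal : ∀ {u v} n → Agree n u v → signal u n ≡ signal v n
    signal-causal n a = does-⇔ (mk⇔ (Ready-transfer n a (count-causal n a))
                                    (Ready-transfer n (Agree-sym a) (sym (count-causal n a)))) em em

  count-fire : ∀ u n → signal u n ≡ true → count u (suc n) ≡ suc (count u n)
  count-fire u n fire = cong (λ s → if s then suc (count u n) else count u n) fire

  count-silent : ∀ u n → ¬ (signal u n ≡ true) → count u (suc n) ≡ count u n
  count-silent u n silent = cong (λ s → if s then suc (count u n) else count u n) (¬-not silent)

  count-step : ∀ u n → count u n ≤ count u (suc n)
  count-step u n = step (signal u n)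
    where
      step : ∀ s → count u n ≤ (if s then suc (count u n) else count u n)
      step true = n≤1+n _
      step false = ≤-refl

  count-mono : ∀ u {N n} → N ≤ n → count u N ≤ count u n
  count-mono u {n = zero} z≤n = ≤-refl
  count-mono u {N} {suc n} N≤1+n with m≤n⇒m<n∨m≡n N≤1+n
  ... | inj₁ N<1+n = ≤-trans (count-mono u (≤-pred N<1+n)) (count-step u n)
  ... | inj₂ refl = ≤-refl

  count-unbounded : ∀ u → InfinitelyOften (signal u) → ∀ K → ∃ λ N → K ≤ count u N
  count-unbounded u io zero = 0 , z≤n
  count-unbounded u io (suc K) =
    let N , K≤c = count-unbounded u io K ; n , N≤n , fire = io N
    in suc n , subst (suc K ≤_) (sym (count-fire u n fire)) (s≤s (≤-trans K≤c (count-mono u N≤n)))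

  -- Late firings certify that u avoids each G j.
  signal-sound : ∀ u → InfinitelyOften (signal u) → ∀ j → ¬ G j u
  signal-sound u io j =
    let N , j≤c = count-unbounded u io j ; n , N≤n , fire = io N
    in does-true em fire j (≤-trans j≤c (count-mono u N≤n)) u (λ _ _ → refl)

  count-frozen : ∀ u N → (∀ n → ¬ (N ≤ n × signal u n ≡ true)) → ∀ d → count u (N + d) ≡ count u N
  count-frozen u N silent zero = cong (count u) (+-identityʳ N)
  count-frozen u N silent (suc d) = begin
    count u (N + suc d)    ≡⟨ cong (count u) (+-suc N d) ⟩
    count u (suc (N + d))  ≡⟨ count-silent u (N + d) (λ fire → silent (N + d) (m≤m+n N d , fire)) ⟩
    count u (N + d)        ≡⟨ count-frozen u N silent d ⟩
    count u N              ∎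
    where open ≡-Reasoning

  -- If u avoids every G j, the signal cannot stay silent after N: the count would be
  -- frozen at c, and a long enough cylinder around u avoids G 0, …, G c.
  signal-complete : ∀ u → (∀ j → ¬ G j u) → InfinitelyOften (signal u)
  signal-complete u avoided N = ¬∀¬⇒∃ fires-eventually
    where
      fires-eventually : ¬ (∀ n → ¬ (N ≤ n × signal u n ≡ true))
      fires-eventually silent =
        let n₀ , avoids = common-threshold (λ j n → Avoids j u n) (λ j → Avoids-mono) (suc (count u N))
                            (λ j _ → G-closed j u (avoided j))
            ready : Ready u (N + n₀)
            ready j j≤c = Avoids-mono (m≤n+m n₀ N)
                            (avoids j (s≤s (subst (j ≤_) (count-frozen u N silent n₀) j≤c)))
        in silent (N + n₀) (m≤m+n N n₀ , dec-true em ready)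

Π⁰₂-reduction : ExcludedMiddle 0ℓ → ∀ {X : Set} {P : PredW X} → Π⁰ 2 P →
  Σ (Word X → Word Bool) λ w → (∀ {u v} n → Agree n u v → w u n ≡ w v n) × (∀ u → P u ⇔ InfinitelyOften (w u))
Π⁰₂-reduction em (G , G-closed , ∁P⇔⋃G) =
  signal , signal-causal , λ u → mk⇔
    (λ Pu → signal-complete u λ j Gju → proj₂ (∁P⇔⋃G u) (j , Gju) Pu)
    (λ io → dne λ ¬Pu → let j , Gju = proj₁ (∁P⇔⋃G u) ¬Pu in signal-sound u io j Gju)
  where
    open Classical em
    open Signal em G (λ j → lower (G-closed j))

-- Every Σ⁰₃ set is the preimage of S under a continuous grid-valued map: column i
-- carries the signal of the i-th Π⁰₂ piece.
Σ⁰₃-reduction : ExcludedMiddle 0ℓ → ∀ {X : Set} {E : PredW X} → Σ⁰ 3 E →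
  Σ (Word X → Grid) λ g → GridContinuous g × (∀ u → E u ⇔ S (g u))
Σ⁰₃-reduction em {X} (F , F-Π⁰₂ , E⇔⋃F) = g , g-continuous , λ u → mk⇔
  (λ Eu → let i , Fiu = proj₁ (E⇔⋃F u) Eu in i , to (column-correct i u) Fiu)
  (λ (i , io) → proj₂ (E⇔⋃F u) (i , from (column-correct i u) io))
  where
    column : ℕ → Word X → Word Bool
    column i = proj₁ (Π⁰₂-reduction em (F-Π⁰₂ i))

    column-causal : ∀ i {u v} n → Agree n u v → column i u n ≡ column i v n
    column-causal i = proj₁ (proj₂ (Π⁰₂-reduction em (F-Π⁰₂ i)))

    column-correct : ∀ i u → F i u ⇔ InfinitelyOften (column i u)
    column-correct i = proj₂ (proj₂ (Π⁰₂-reduction em (F-Π⁰₂ i)))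

    g : Word X → Grid
    g u i = column i u

    g-continuous : GridContinuous g
    g-continuous u K = K , λ v a m n _ n<K → column-causal m n (Agree-weaken (<⇒≤ n<K) a)

ContinuousPreimage : {Y X : Set} → PredW Y → PredW X → Set
ContinuousPreimage {Y} {X} E F =
  Σ (Word Y → Word X) λ f → Continuous f × (∀ u → (E u → F (f u)) × (F (f u) → E u))

lemma4 : ExcludedMiddle 0ℓ → IsΣ⁰Complete 3 𝒮
lemma4 em k E = hardness , membership
  where
    -- A Σ⁰₃ set reduces to S, and then to 𝒮 through the coding h.
    hardness : Σ⁰ 3 E → ContinuousPreimage E 𝒮
    hardness E-Σ⁰₃ =
      let g , g-continuous , E⇔Sg = Σ⁰₃-reduction em E-Σ⁰₃
          E⇔𝒮hg = λ u → ⇔-trans (E⇔Sg u) (⇔-sym (𝒮-on-codes (g u)))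
      in (λ u → h (g u)) , h∘-continuous g g-continuous , λ u → to (E⇔𝒮hg u) , from (E⇔𝒮hg u)

    membership : ContinuousPreimage E 𝒮 → Σ⁰ 3 E
    membership (f , f-continuous , E⇔f⁻¹𝒮) =
      Σ⁰-resp 3 (λ u → mk⇔ (proj₂ (E⇔f⁻¹𝒮 u)) (proj₁ (E⇔f⁻¹𝒮 u))) (Σ⁰-preimage 3 f f-continuous (𝒮-Σ⁰₃ em))
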